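{- For $a\in\{5,6,7,8\}$ and for every integer $a\ge 10$, $$ g(a,a+5,a+6,a+7)=\left(2+\left\lfloor \frac{a+1}{7}\right\rfloor\right)a+9. $$
   Context: For positive integers $a_1,\dots,a_m$ with $\gcd(a_1,\dots,a_m)=1$, the Frobenius number $g(a_1,\dots,a_m)$ is the largest positive integer that cannot be written as $x_1a_1+\cdots+x_ma_m$ with nonnegative integers $x_i$. $\lfloor x\rfloor$ is the floor. -}

module Defs where

open import Data.Nat using (ℕ; _+_; _*_; _<_)
open import Data.List using (List; []; _∷_)
open import Data.Product using (∃)
open import Relation.Nullary using (¬_)
open import Relation.Binary.PropositionalEquality using (_≡_)

Representable : List ℕ → ℕ → Set
Representable []       n = n ≡ 0
Representable (a ∷ as) n = ∃ λ x → ∃ λ m → n ≡ x * a + m × Representable as m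
  where open import Data.Product using (_×_)

IsFrobeniusNumber : List ℕ → ℕ → Set
IsFrobeniusNumber as g =
  (0 < g) × (¬ Representable as g) × (∀ n → g < n → Representable as n)
  where open import Data.Product using (_×_)

-- A number is representable by a, a+5, a+6, a+7 iff it is t·a + s, where s is a sum of
-- c ≤ t elements of {5,6,7}; such a sum satisfies 5c ≤ s ≤ 7c.  Put q = ⌊(a+1)/7⌋.
-- Every n ≥ 10 is a sum of ⌈n/7⌉ elements of {5,6,7}, and ⌈(10+d)/7⌉ ≤ 2+q for d < a,
-- so the a consecutive numbers (2+q)a + 10 + d are representable, hence so is everything
-- above them.  If (2+q)a + 9 = t·a + s, then t ≤ 1+q is too small because s ≤ 7t and
-- 7q ≤ a+1; t = 2+q would make 9 a sum of elements of {5,6,7}; and t > 2+q leaves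
-- 9 = k·a + s with k ≥ 1, which forces a = 9 or a total of at least 10.
module Submission where

open import Defs
open import Data.Nat using (ℕ; _+_; _*_; _/_; _≤_)
open import Data.List using (List; []; _∷_)
open import Data.Sum using (_⊎_)
open import Relation.Binary.PropositionalEquality using (_≡_)

open import Data.Nat using (zero; suc; _<_; _∸_; _%_; NonZero; >-nonZero; z≤n; s≤s)
open import Data.Nat.Properties
open import Data.Nat.DivMod using (m≡m%n+[m/n]*n; m%n<n; m/n*n≤m)
open import Data.Nat.Tactic.RingSolver using (solve)
open import Data.List using (map)
open import Data.List.Membership.Propositional using (_∈_)
open import Data.List.Membership.Propositional.Properties using (∈-map⁺)
import Data.List.Relation.Unary.All as All
open All using (All)
open import Data.List.Relation.Unary.Any using (here; there)
open import Data.Product using (∃; ∃₂; _×_; _,_)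
open import Data.Sum using (inj₁; inj₂)
open import Data.Unit using (tt)
open import Relation.Nullary using (¬_; yes; no)
open import Relation.Binary.PropositionalEquality using (refl; sym; trans; cong; subst; _≢_; module ≡-Reasoning)

private variable
  a b c m n q s t : ℕ
  bs xs : List ℕ

data SumOf (bs : List ℕ) : ℕ → ℕ → Set where
  []  : SumOf bs 0 0
  _∷_ : b ∈ bs → SumOf bs c s → SumOf bs (suc c) (b + s)

SumOf-weaken : (∀ {x} → x ∈ bs → x ∈ xs) → SumOf bs c s → SumOf xs c s
SumOf-weaken f []      = []
SumOf-weaken f (p ∷ σ) = f p ∷ SumOf-weaken f σ

SumOf-replicate : b ∈ bs → ∀ k → SumOf bs c s → SumOf bs (k + c) (k * b + s)
SumOf-replicate p zero    σ = σ
SumOf-replicate {b} {s = s} p (suc k) σ =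
  subst (SumOf _ _) (sym (+-assoc b (k * b) s)) (p ∷ SumOf-replicate p k σ)

SumOf-lowerBound : All (m ≤_) bs → SumOf bs c s → c * m ≤ s
SumOf-lowerBound ms []      = z≤n
SumOf-lowerBound ms (p ∷ σ) = +-mono-≤ (All.lookup ms p) (SumOf-lowerBound ms σ)

SumOf-upperBound : All (_≤ m) bs → SumOf bs c s → s ≤ c * m
SumOf-upperBound ms []      = z≤n
SumOf-upperBound ms (p ∷ σ) = +-mono-≤ (All.lookup ms p) (SumOf-upperBound ms σ)

representable-0 : ∀ xs → Representable xs 0
representable-0 []       = refl
representable-0 (x ∷ xs) = 0 , 0 , refl , representable-0 xs

representable-+∈ : b ∈ xs → Representable xs n → Representable xs (b + n)
representable-+∈ {b} (here refl) (k , m , refl , r) = suc k , m , sym (+-assoc b (k * b) m) , r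
representable-+∈ {b} (there {x} p) (k , m , refl , r) =
  k , b + m , solve (b ∷ k ∷ x ∷ m ∷ []) , representable-+∈ p r

representable-+* : ∀ k → Representable (a ∷ xs) n → Representable (a ∷ xs) (k * a + n)
representable-+* {a} k (x , m , refl , r) = k + x , m , solve (k ∷ x ∷ a ∷ m ∷ []) , r

representable-beyond : .{{_ : NonZero a}} → (∀ d → d < a → Representable (a ∷ xs) (m + d)) →
                       ∀ n → m ≤ n → Representable (a ∷ xs) n
representable-beyond {a} {m = m} window n m≤n =
  subst (Representable _) decompose (representable-+* (e / a) (window (e % a) (m%n<n e a)))
  where
  e = n ∸ m
  open ≡-Reasoning
  decompose : e / a * a + (m + e % a) ≡ n
  decompose = begin
    e / a * a + (m + e % a) ≡⟨ +-comm (e / a * a) (m + e % a) ⟩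
    m + e % a + e / a * a   ≡⟨ +-assoc m (e % a) (e / a * a) ⟩
    m + (e % a + e / a * a) ≡⟨ cong (m +_) (m≡m%n+[m/n]*n e a) ⟨
    m + e                   ≡⟨ m+[n∸m]≡n m≤n ⟩
    n                       ∎

representable-map-+ : SumOf bs c s → Representable (map (a +_) bs) (c * a + s)
representable-map-+ [] = representable-0 _
representable-map-+ {a = a} (_∷_ {b} {c} {s} p σ) =
  subst (Representable _) eq (representable-+∈ (∈-map⁺ (a +_) p) (representable-map-+ σ))
  where
  eq : a + b + (c * a + s) ≡ suc c * a + (b + s)
  eq = solve (a ∷ b ∷ c ∷ s ∷ [])

representable-map-+⁻¹ : ∀ bs → Representable (map (a +_) bs) n →
                        ∃₂ λ c s → SumOf bs c s × n ≡ c * a + s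
representable-map-+⁻¹ []       refl = 0 , 0 , [] , refl
representable-map-+⁻¹ {a} (b ∷ bs) (k , m , refl , r) with representable-map-+⁻¹ bs r
... | c , s , σ , refl =
  k + c , k * b + s , SumOf-replicate (here refl) k (SumOf-weaken there σ) , solve (k ∷ a ∷ b ∷ c ∷ s ∷ [])

representable-shifted : c ≤ t → SumOf bs c s → Representable (a ∷ map (a +_) bs) (t * a + s)
representable-shifted {c} {s = s} {a} c≤t σ with m≤n⇒∃[o]m+o≡n c≤t
... | d , refl = d , c * a + s , regroup , representable-map-+ σ
  where
  regroup : (c + d) * a + s ≡ d * a + (c * a + s)
  regroup = solve (c ∷ d ∷ a ∷ s ∷ [])

representable-shifted⁻¹ : Representable (a ∷ map (a +_) bs) n →
                          ∃₂ λ t c → ∃ λ s → c ≤ t × SumOf bs c s × n ≡ t * a + s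
representable-shifted⁻¹ {a} {bs} (x , m , refl , r) with representable-map-+⁻¹ bs r
... | c , s , σ , refl = x + c , c , s , m≤n+m c x , σ , regroup
  where
  regroup : x * a + (c * a + s) ≡ (x + c) * a + s
  regroup = solve (x ∷ a ∷ c ∷ s ∷ [])

m<[1+m/n]*n : ∀ m n .{{_ : NonZero n}} → m < (1 + m / n) * n
m<[1+m/n]*n m n = begin-strict
  m                 ≡⟨ m≡m%n+[m/n]*n m n ⟩
  m % n + m / n * n <⟨ +-monoˡ-< (m / n * n) (m%n<n m n) ⟩
  n + m / n * n     ∎
  where open ≤-Reasoning

shifts : List ℕ
shifts = 5 ∷ 6 ∷ 7 ∷ []

shifts≥5 : All (5 ≤_) shifts
shifts≥5 = ≤ᵇ⇒≤ _ _ tt All.∷ ≤ᵇ⇒≤ _ _ tt All.∷ ≤ᵇ⇒≤ _ _ tt All.∷ All.[]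

shifts≤7 : All (_≤ 7) shifts
shifts≤7 = ≤ᵇ⇒≤ _ _ tt All.∷ ≤ᵇ⇒≤ _ _ tt All.∷ ≤ᵇ⇒≤ _ _ tt All.∷ All.[]

5∈shifts : 5 ∈ shifts
5∈shifts = here refl

6∈shifts : 6 ∈ shifts
6∈shifts = there (here refl)

7∈shifts : 7 ∈ shifts
7∈shifts = there (there (here refl))

SumOf-shifts-10+ : ∀ i → ∃ λ c → c * 7 ≤ 16 + i × SumOf shifts c (10 + i)
SumOf-shifts-10+ 0 = 2 , ≤ᵇ⇒≤ _ _ tt , 5∈shifts ∷ 5∈shifts ∷ []
SumOf-shifts-10+ 1 = 2 , ≤ᵇ⇒≤ _ _ tt , 5∈shifts ∷ 6∈shifts ∷ []
SumOf-shifts-10+ 2 = 2 , ≤ᵇ⇒≤ _ _ tt , 6∈shifts ∷ 6∈shifts ∷ []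
SumOf-shifts-10+ 3 = 2 , ≤ᵇ⇒≤ _ _ tt , 6∈shifts ∷ 7∈shifts ∷ []
SumOf-shifts-10+ 4 = 2 , ≤ᵇ⇒≤ _ _ tt , 7∈shifts ∷ 7∈shifts ∷ []
SumOf-shifts-10+ 5 = 3 , ≤ᵇ⇒≤ _ _ tt , 5∈shifts ∷ 5∈shifts ∷ 5∈shifts ∷ []
SumOf-shifts-10+ 6 = 3 , ≤ᵇ⇒≤ _ _ tt , 5∈shifts ∷ 5∈shifts ∷ 6∈shifts ∷ []
SumOf-shifts-10+ (suc (suc (suc (suc (suc (suc (suc i))))))) with SumOf-shifts-10+ i
... | c , bound , σ = suc c , +-monoʳ-≤ 7 bound , 7∈shifts ∷ σ

-- ≤⇒≤ᵇ refutes a false inequality between literals: T (9 ≤ᵇ 7) computes to ⊥.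
¬SumOf-shifts-9 : ¬ SumOf shifts c 9
¬SumOf-shifts-9 {zero}        σ = ≤⇒≤ᵇ (SumOf-upperBound shifts≤7 σ)
¬SumOf-shifts-9 {1}           σ = ≤⇒≤ᵇ (SumOf-upperBound shifts≤7 σ)
¬SumOf-shifts-9 {suc (suc c)} σ = ≤⇒≤ᵇ (≤-trans (m≤m+n 10 (c * 5)) (SumOf-lowerBound shifts≥5 σ))

shifted-excess≢9 : 5 ≤ a → a ≢ 9 → SumOf shifts c s → ∀ k → k * a + s ≢ 9
shifted-excess≢9 _ _ σ 0 s≡9 = ¬SumOf-shifts-9 (subst (SumOf shifts _) s≡9 σ)
shifted-excess≢9 {a} _ a≢9 [] 1 a+0+0≡9 =
  a≢9 (trans (sym (trans (+-identityʳ (a + 0)) (+-identityʳ a))) a+0+0≡9)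
shifted-excess≢9 {a} 5≤a _ (p ∷ σ) 1 eq =
  ≤⇒≤ᵇ (subst (10 ≤_) eq (+-mono-≤ (≤-trans 5≤a (m≤m+n a 0)) (≤-trans (All.lookup shifts≥5 p) (m≤m+n _ _))))
shifted-excess≢9 {a} {s = s} 5≤a _ _ (suc (suc k)) eq =
  ≤⇒≤ᵇ (subst (10 ≤_) eq (≤-trans (+-mono-≤ 5≤a (≤-trans 5≤a (m≤m+n a (k * a)))) (m≤m+n _ s)))

shifted-sum<frobenius : q * 7 ≤ a + 1 → c ≤ t → t ≤ 1 + q → SumOf shifts c s → t * a + s < (2 + q) * a + 9
shifted-sum<frobenius {q} {a} {c} {t} {s} q*7≤a+1 c≤t t≤1+q σ = begin-strict
  t * a + s                   ≤⟨ +-monoʳ-≤ (t * a) (SumOf-upperBound shifts≤7 σ) ⟩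
  t * a + c * 7               ≤⟨ +-monoʳ-≤ (t * a) (*-monoˡ-≤ 7 c≤t) ⟩
  t * a + t * 7               ≤⟨ +-mono-≤ (*-monoˡ-≤ a t≤1+q) (*-monoˡ-≤ 7 t≤1+q) ⟩
  (1 + q) * a + (7 + q * 7)   ≤⟨ +-monoʳ-≤ ((1 + q) * a) (+-monoʳ-≤ 7 q*7≤a+1) ⟩
  (1 + q) * a + (7 + (a + 1)) ≡⟨ solve (q ∷ a ∷ []) ⟩
  (2 + q) * a + 8             <⟨ +-monoʳ-< ((2 + q) * a) (n<1+n 8) ⟩
  (2 + q) * a + 9             ∎
  where open ≤-Reasoning

shifted-frobenius-not-representable : 5 ≤ a → a ≢ 9 → q * 7 ≤ a + 1 →
  ¬ Representable (a ∷ map (a +_) shifts) ((2 + q) * a + 9)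
shifted-frobenius-not-representable {a} {q} 5≤a a≢9 q*7≤a+1 r with representable-shifted⁻¹ r
... | t , c , s , c≤t , σ , eq with t ≤? 1 + q
...   | yes t≤1+q = <-irrefl (sym eq) (shifted-sum<frobenius q*7≤a+1 c≤t t≤1+q σ)
...   | no t≰1+q with m≤n⇒∃[o]m+o≡n (≰⇒> t≰1+q)
...     | k , refl = shifted-excess≢9 5≤a a≢9 σ k (sym (+-cancelˡ-≡ ((2 + q) * a) 9 _ (trans eq regroup)))
  where
  regroup : (2 + q + k) * a + s ≡ (2 + q) * a + (k * a + s)
  regroup = solve (q ∷ k ∷ a ∷ s ∷ [])

shifted-representable-above-frobenius : .{{_ : NonZero a}} → a + 1 < (1 + q) * 7 →
  ∀ n → (2 + q) * a + 9 < n → Representable (a ∷ map (a +_) shifts) n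
shifted-representable-above-frobenius {a} {q} a+1<[1+q]*7 = representable-beyond window
  where
  16+a≤[3+q]*7 : 16 + a ≤ (3 + q) * 7
  16+a≤[3+q]*7 = subst (_≤ (3 + q) * 7) (cong (15 +_) (+-comm a 1)) (+-monoʳ-≤ 14 a+1<[1+q]*7)
  window : ∀ d → d < a → Representable (a ∷ map (a +_) shifts) (suc ((2 + q) * a + 9) + d)
  window d d<a with SumOf-shifts-10+ d
  ... | c , c*7≤16+d , σ = subst (Representable _) regroup (representable-shifted c≤2+q σ)
    where
    c≤2+q : c ≤ 2 + q
    c≤2+q = ≤-pred (*-cancelʳ-< 7 c (3 + q) (≤-<-trans c*7≤16+d (≤-trans (+-monoʳ-< 16 d<a) 16+a≤[3+q]*7)))
    regroup : (2 + q) * a + (10 + d) ≡ suc ((2 + q) * a + 9) + d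
    regroup = solve (q ∷ a ∷ d ∷ [])

shifted-frobenius : ∀ q → 5 ≤ a → a ≢ 9 → q * 7 ≤ a + 1 → a + 1 < (1 + q) * 7 →
  IsFrobeniusNumber (a ∷ map (a +_) shifts) ((2 + q) * a + 9)
shifted-frobenius {a} q 5≤a a≢9 q*7≤a+1 a+1<[1+q]*7 =
  ≤-trans (s≤s z≤n) (m≤n+m 9 ((2 + q) * a)) ,
  shifted-frobenius-not-representable {q = q} 5≤a a≢9 q*7≤a+1 ,
  shifted-representable-above-frobenius {q = q} a+1<[1+q]*7
  where
  instance
    a≢0 : NonZero a
    a≢0 = >-nonZero (≤-trans (s≤s z≤n) 5≤a)

admissible : a ≡ 5 ⊎ a ≡ 6 ⊎ a ≡ 7 ⊎ a ≡ 8 ⊎ 10 ≤ a → 5 ≤ a × a ≢ 9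
admissible (inj₁ refl)                      = ≤ᵇ⇒≤ _ _ tt , λ ()
admissible (inj₂ (inj₁ refl))               = ≤ᵇ⇒≤ _ _ tt , λ ()
admissible (inj₂ (inj₂ (inj₁ refl)))        = ≤ᵇ⇒≤ _ _ tt , λ ()
admissible (inj₂ (inj₂ (inj₂ (inj₁ refl)))) = ≤ᵇ⇒≤ _ _ tt , λ ()
admissible (inj₂ (inj₂ (inj₂ (inj₂ 10≤a)))) = ≤-trans (≤ᵇ⇒≤ _ _ tt) 10≤a , λ { refl → ≤⇒≤ᵇ 10≤a }

-- The generator list is definitionally a ∷ map (a +_) shifts.
corollary11 : ∀ (a : ℕ) → (a ≡ 5 ⊎ a ≡ 6 ⊎ a ≡ 7 ⊎ a ≡ 8 ⊎ 10 ≤ a) →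
    IsFrobeniusNumber (a ∷ (a + 5) ∷ (a + 6) ∷ (a + 7) ∷ []) ((2 + (a + 1) / 7) * a + 9)
corollary11 a h with admissible h
... | 5≤a , a≢9 = shifted-frobenius ((a + 1) / 7) 5≤a a≢9 (m/n*n≤m (a + 1) 7) (m<[1+m/n]*n (a + 1) 7)
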